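{- For the path $P_n$ of order $n\geq 3$, $\gamma(C(P_n))=\lceil n/2\rceil$ if $n\in\{3,4,5\}$, and $\gamma(C(P_n))=\lfloor n/2\rfloor$ otherwise.
   Context: The central graph $C(G)$ of a simple graph $G$ is obtained from $G$ by subdividing each edge of $G$ exactly once and joining every pair of vertices non-adjacent in $G$ by an edge. $\gamma$ denotes the domination number. -}

module Defs where

open import Data.Nat using (ℕ; suc; _≤_)
open import Data.Fin using (Fin; toℕ; _<_)
open import Data.Product using (Σ; Σ-syntax; _×_; _,_; proj₁; proj₂; ∃-syntax)
open import Data.Sum using (_⊎_; inj₁; inj₂)
open import Data.Empty using (⊥)
open import Data.List using (List; length)
open import Data.List.Membership.Propositional using (_∈_)
open import Data.List.Relation.Unary.Unique.Propositional using (Unique)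
open import Relation.Nullary using (¬_)
open import Relation.Binary.PropositionalEquality using (_≡_; _≢_)

record SimpleGraph : Set₁ where
  field
    n      : ℕ
    Adj    : Fin n → Fin n → Set
    sym    : ∀ {u v} → Adj u v → Adj v u
    irrefl : ∀ {u} → ¬ Adj u u
open SimpleGraph public

PathAdj : (n : ℕ) → Fin n → Fin n → Set
PathAdj n i j = (toℕ j ≡ suc (toℕ i)) ⊎ (toℕ i ≡ suc (toℕ j))

private
  n≢1+n : ∀ {m : ℕ} → ¬ (m ≡ suc m)
  n≢1+n ()

Path : ℕ → SimpleGraph
Path n = record
  { n = n
  ; Adj = PathAdj n
  ; sym = λ { (inj₁ e) → inj₂ e ; (inj₂ e) → inj₁ e }
  ; irrefl = λ { (inj₁ e) → n≢1+n e ; (inj₂ e) → n≢1+n e }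
  }

Edge : SimpleGraph → Set
Edge G = Σ[ p ∈ Fin (n G) × Fin (n G) ] (proj₁ p < proj₂ p × Adj G (proj₁ p) (proj₂ p))

-- Vertices of the central graph C(G): original vertices plus one subdivision
-- vertex per edge.
CentralV : SimpleGraph → Set
CentralV G = Fin (n G) ⊎ Edge G

CentralAdj : (G : SimpleGraph) → CentralV G → CentralV G → Set
CentralAdj G (inj₁ u) (inj₁ v) = u ≢ v × ¬ Adj G u v
CentralAdj G (inj₁ u) (inj₂ ((a , b) , _)) = (u ≡ a) ⊎ (u ≡ b)
CentralAdj G (inj₂ ((a , b) , _)) (inj₁ u) = (u ≡ a) ⊎ (u ≡ b)
CentralAdj G (inj₂ _) (inj₂ _) = ⊥

Dominating : {V : Set} → (V → V → Set) → List V → Set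
Dominating {V} A S = ∀ (v : V) → (v ∈ S) ⊎ (∃[ s ] (s ∈ S × A s v))

IsDominationNumber : {V : Set} → (V → V → Set) → ℕ → Set
IsDominationNumber {V} A k =
  (∃[ S ] (Unique S × Dominating A S × length S ≡ k))
  × (∀ (S : List V) → Unique S → Dominating A S → k ≤ length S)

{-# OPTIONS --safe #-}
module Submission where

-- Each vertex of C(Pₙ) dominates at most two of the n − 1 subdivision
-- vertices (a path vertex only those of its incident edges, a subdivision
-- vertex only itself), so γ ≥ ⌈(n − 1)/2⌉ = ⌊n/2⌋. For n ≥ 6 the odd path
-- vertices attain this bound: every edge of Pₙ has an odd endpoint, and every
-- path vertex is distinct from and non-adjacent in Pₙ to vertex 1 or vertex 5.
-- For n ∈ {3, 5} exhaustive search over a finite model of C(Pₙ) shows that no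
-- ⌊n/2⌋ vertices dominate.

open import Defs hiding (sym)
open import Data.Nat using (ℕ; _≤_; ⌊_/2⌋; ⌈_/2⌉)
open import Data.Product using (_×_)

open import Data.Nat as ℕ using (zero; suc; pred; _*_; _+_; z≤n; s≤s)
open import Data.Nat.Properties
  using (≤-trans; ≤-reflexive; pred-mono-≤; +-suc; +-mono-≤; *-suc; <-asym; ≤∧≢⇒<; module ≤-Reasoning)
open import Data.Fin as F using (Fin; toℕ; fromℕ<; inject₁; #_)
open import Data.Fin.Properties using (toℕ-injective; toℕ<n; toℕ-fromℕ<; toℕ-inject₁; all?; injective⇒≤)
  renaming (_≟_ to _≟ᶠ_)
open import Data.Product using (∃-syntax; _,_; proj₁; proj₂)
open import Data.Sum as Sum using (_⊎_; inj₁; inj₂; [_,_])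
open import Data.Sum.Properties using (inj₁-injective; ≡-dec)
open import Data.Empty using (⊥; ⊥-elim)
open import Data.Unit using (tt)
open import Data.List using (List; []; _∷_; _++_; map; length; lookup; concatMap)
open import Data.List.Properties using (length-map; length-++)
open import Data.List.Relation.Unary.Any using (here; there; any?) renaming (index to indexOf)
open import Data.List.Relation.Unary.Any.Properties using (lookup-index)
open import Data.List.Relation.Unary.All using (All; []; _∷_)
open import Data.List.Relation.Unary.AllPairs using ([]; _∷_)
open import Data.List.Membership.Propositional using (_∈_; find; lose)
open import Data.List.Membership.Propositional.Properties using (∈-map⁺; ∈-map⁻; ∈-concatMap⁺)
open import Data.List.Relation.Unary.Unique.Propositional using (Unique)
open import Data.List.Relation.Unary.Unique.Propositional.Properties using (map⁺)
open import Function using (_∘_; id)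
open import Function.Definitions using (Injective)
open import Relation.Nullary using (¬_; Dec; no; ¬?)
open import Relation.Nullary.Decidable using (_×-dec_; _⊎-dec_; map′; toWitness)
open import Relation.Unary using (Decidable)
open import Relation.Binary using (DecidableEquality) renaming (Decidable to Decidable₂)
open import Relation.Binary.PropositionalEquality
  using (_≡_; _≢_; refl; sym; trans; cong; subst; ≢-sym; module ≡-Reasoning)

∈-injective⇒≤-length : ∀ {A : Set} {m} {f : Fin m → A} {xs : List A} →
  Injective _≡_ _≡_ f → (∀ i → f i ∈ xs) → m ≤ length xs
∈-injective⇒≤-length {f = f} {xs} f-injective f∈xs = injective⇒≤ position-injective
  where
  open ≡-Reasoning
  position-injective : Injective _≡_ _≡_ (indexOf ∘ f∈xs)
  position-injective {i} {j} eq = f-injective (begin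
    f i                          ≡⟨ lookup-index (f∈xs i) ⟩
    lookup xs (indexOf (f∈xs i)) ≡⟨ cong (lookup xs) eq ⟩
    lookup xs (indexOf (f∈xs j)) ≡⟨ sym (lookup-index (f∈xs j)) ⟩
    f j                          ∎)

length-concatMap-≤ : ∀ {A B : Set} {f : A → List B} {k} →
  (∀ x → length (f x) ≤ k) → ∀ xs → length (concatMap f xs) ≤ k * length xs
length-concatMap-≤ _ [] = z≤n
length-concatMap-≤ {f = f} {k} bound (x ∷ xs) = begin
  length (f x ++ concatMap f xs)         ≡⟨ length-++ (f x) ⟩
  length (f x) + length (concatMap f xs) ≤⟨ +-mono-≤ (bound x) (length-concatMap-≤ bound xs) ⟩
  k + k * length xs                      ≡⟨ sym (*-suc k (length xs)) ⟩
  k * suc (length xs)                    ∎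
  where open ≤-Reasoning

pred≤2*⇒⌊/2⌋≤ : ∀ n l → pred n ≤ 2 * l → ⌊ n /2⌋ ≤ l
pred≤2*⇒⌊/2⌋≤ zero          l       _ = z≤n
pred≤2*⇒⌊/2⌋≤ (suc zero)    l       _ = z≤n
pred≤2*⇒⌊/2⌋≤ (suc (suc n)) (suc l) (s≤s n≤2l+1) =
  s≤s (pred≤2*⇒⌊/2⌋≤ n l (≤-trans (pred-mono-≤ n≤2l+1) (≤-reflexive (cong pred (+-suc l (l + 0))))))

dominator : ∀ {V : Set} {A : V → V → Set} {S} → Dominating A S → ∀ v → ∃[ s ] (s ∈ S × (s ≡ v ⊎ A s v))
dominator D v with D v
... | inj₁ v∈S             = v , v∈S , inj₁ refl
... | inj₂ (s , s∈S , Asv) = s , s∈S , inj₂ Asv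

module _ {V : Set} {A : V → V → Set} where

  dominating? : DecidableEquality V → (∀ {P : V → Set} → Decidable P → Dec (∀ v → P v)) →
    Decidable₂ A → ∀ S → Dec (Dominating A S)
  dominating? _≟_ all-V? A? S = all-V? λ v →
    any? (v ≟_) S ⊎-dec map′ find (λ (s , s∈S , Asv) → lose s∈S Asv) (any? (λ s → A? s v) S)

  module _ {W : Set} {B : W → W → Set} (f : V → W) where

    Dominating-map : (g : W → V) → (∀ w → f (g w) ≡ w) → (∀ {x y} → A x y → B (f x) (f y)) →
      ∀ {S} → Dominating A S → Dominating B (map f S)
    Dominating-map g f∘g≡id f-hom {S} D w with dominator D (g w)
    ... | s , s∈S , inj₁ refl = inj₁ (subst (_∈ map f S) (f∘g≡id w) (∈-map⁺ f s∈S))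
    ... | s , s∈S , inj₂ Asv  = inj₂ (f s , ∈-map⁺ f s∈S , subst (B (f s)) (f∘g≡id w) (f-hom Asv))

    Dominating-reflect : ∀ {U : Set} (h : U → V) →
      (∀ t {v} → f (h t) ≡ f v → h t ≡ v) → (∀ t {v} → B (f (h t)) (f v) → A (h t) v) →
      ∀ T → Dominating B (map (f ∘ h) T) → Dominating A (map h T)
    Dominating-reflect h f-injective f-reflects T D v with dominator D (f v)
    ... | s , s∈fhT , s-near-fv with ∈-map⁻ (f ∘ h) s∈fhT
    ...   | t , t∈T , refl with s-near-fv
    ...     | inj₁ eq  = inj₁ (subst (_∈ map h T) (f-injective t eq) (∈-map⁺ h t∈T))
    ...     | inj₂ Bsv = inj₂ (h t , ∈-map⁺ h t∈T , f-reflects t Bsv)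

edge-succ : ∀ {n} {a b : Fin n} → toℕ a ℕ.< toℕ b → PathAdj n a b → toℕ b ≡ suc (toℕ a)
edge-succ _   (inj₁ b≡1+a) = b≡1+a
edge-succ a<b (inj₂ a≡1+b) = ⊥-elim (<-asym a<b (≤-reflexive (sym a≡1+b)))

-- Finite model of C(Pₙ): inj₁ i is the path vertex i, and inj₂ k the
-- subdivision vertex of the edge {k, k + 1}.
Code : ℕ → Set
Code n = Fin n ⊎ Fin (pred n)

IsEndpoint : ∀ {n} → Fin n → Fin (pred n) → Set
IsEndpoint u k = toℕ u ≡ toℕ k ⊎ toℕ u ≡ suc (toℕ k)

CodeAdj : (n : ℕ) → Code n → Code n → Set
CodeAdj n (inj₁ u) (inj₁ w) = CentralAdj (Path n) (inj₁ u) (inj₁ w)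
CodeAdj n (inj₁ u) (inj₂ k) = IsEndpoint u k
CodeAdj n (inj₂ k) (inj₁ u) = IsEndpoint u k
CodeAdj n (inj₂ _) (inj₂ _) = ⊥

module _ {n : ℕ} where

  edgeIndex : Edge (Path n) → Fin (pred n)
  edgeIndex ((a , b) , a<b , ab) =
    fromℕ< (pred-mono-≤ (subst (ℕ._< n) (edge-succ a<b ab) (toℕ<n b)))

  encode : CentralV (Path n) → Code n
  encode (inj₁ u) = inj₁ u
  encode (inj₂ e) = inj₂ (edgeIndex e)

  toℕ-edgeIndex : ∀ (e : Edge (Path n)) → toℕ (edgeIndex e) ≡ toℕ (proj₁ (proj₁ e))
  toℕ-edgeIndex _ = toℕ-fromℕ< _

  endpoint⇒IsEndpoint : ∀ {u} (e : Edge (Path n)) →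
    (u ≡ proj₁ (proj₁ e)) ⊎ (u ≡ proj₂ (proj₁ e)) → IsEndpoint u (edgeIndex e)
  endpoint⇒IsEndpoint e (inj₁ refl) = inj₁ (sym (toℕ-edgeIndex e))
  endpoint⇒IsEndpoint e@(_ , a<b , ab) (inj₂ refl) =
    inj₂ (trans (edge-succ a<b ab) (cong suc (sym (toℕ-edgeIndex e))))

  IsEndpoint⇒endpoint : ∀ {u} (e : Edge (Path n)) →
    IsEndpoint u (edgeIndex e) → (u ≡ proj₁ (proj₁ e)) ⊎ (u ≡ proj₂ (proj₁ e))
  IsEndpoint⇒endpoint e (inj₁ u≡k) = inj₁ (toℕ-injective (trans u≡k (toℕ-edgeIndex e)))
  IsEndpoint⇒endpoint e@(_ , a<b , ab) (inj₂ u≡1+k) =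
    inj₂ (toℕ-injective (trans u≡1+k (trans (cong suc (toℕ-edgeIndex e)) (sym (edge-succ a<b ab)))))

  encode-adj : ∀ {x y} → CentralAdj (Path n) x y → CodeAdj n (encode x) (encode y)
  encode-adj {inj₁ _} {inj₁ _} uw = uw
  encode-adj {inj₁ _} {inj₂ e} ue = endpoint⇒IsEndpoint e ue
  encode-adj {inj₂ e} {inj₁ _} ue = endpoint⇒IsEndpoint e ue
  encode-adj {inj₂ _} {inj₂ _} ()

  encode-adj⁻ : ∀ u {v} → CodeAdj n (inj₁ u) (encode v) → CentralAdj (Path n) (inj₁ u) v
  encode-adj⁻ u {inj₁ _} uw = uw
  encode-adj⁻ u {inj₂ e} ue = IsEndpoint⇒endpoint e ue

  encode-injective₁ : ∀ u {v} → encode (inj₁ u) ≡ encode v → inj₁ u ≡ v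
  encode-injective₁ u {inj₁ _} refl = refl

decode : ∀ {n} → Code n → CentralV (Path n)
decode          (inj₁ u) = inj₁ u
decode {suc n} (inj₂ k) =
  inj₂ ((inject₁ k , F.suc k) , s≤s (≤-reflexive (toℕ-inject₁ k)) , inj₁ (cong suc (sym (toℕ-inject₁ k))))

encode-decode : ∀ {n} (c : Code n) → encode (decode c) ≡ c
encode-decode          (inj₁ u) = refl
encode-decode {suc n} (inj₂ k) = cong inj₂ (toℕ-injective (trans (toℕ-fromℕ< _) (toℕ-inject₁ k)))

encode-dominating : ∀ {n S} → Dominating (CentralAdj (Path n)) S → Dominating (CodeAdj n) (map encode S)
encode-dominating = Dominating-map encode decode encode-decode encode-adj

vertices-dominating : ∀ {n} (T : List (Fin n)) →
  Dominating (CodeAdj n) (map inj₁ T) → Dominating (CentralAdj (Path n)) (map inj₁ T)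
vertices-dominating = Dominating-reflect encode inj₁ encode-injective₁ encode-adj⁻

module _ {n : ℕ} where

  all-code? : ∀ {P : Code n → Set} → Decidable P → Dec (∀ c → P c)
  all-code? P? = map′ (λ (p₁ , p₂) → [ p₁ , p₂ ]) (λ p → p ∘ inj₁ , p ∘ inj₂)
    (all? (P? ∘ inj₁) ×-dec all? (P? ∘ inj₂))

  codeAdj? : Decidable₂ (CodeAdj n)
  codeAdj? (inj₁ u) (inj₁ w) = ¬? (u ≟ᶠ w) ×-dec ¬? (pathAdj? u w)
    where pathAdj? = λ u w → (toℕ w ℕ.≟ suc (toℕ u)) ⊎-dec (toℕ u ℕ.≟ suc (toℕ w))
  codeAdj? (inj₁ u) (inj₂ k) = (toℕ u ℕ.≟ toℕ k) ⊎-dec (toℕ u ℕ.≟ suc (toℕ k))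
  codeAdj? (inj₂ k) (inj₁ u) = (toℕ u ℕ.≟ toℕ k) ⊎-dec (toℕ u ℕ.≟ suc (toℕ k))
  codeAdj? (inj₂ _) (inj₂ _) = no id

  codeDominating? : ∀ L → Dec (Dominating (CodeAdj n) L)
  codeDominating? = dominating? (≡-dec _≟ᶠ_ _≟ᶠ_) all-code? codeAdj?

  nearSubdivisions : Code n → List ℕ
  nearSubdivisions (inj₁ u) = toℕ u ∷ pred (toℕ u) ∷ []
  nearSubdivisions (inj₂ k) = toℕ k ∷ []

  length-nearSubdivisions : ∀ c → length (nearSubdivisions c) ≤ 2
  length-nearSubdivisions (inj₁ _) = s≤s (s≤s z≤n)
  length-nearSubdivisions (inj₂ _) = s≤s z≤n

  dominated-subdivision∈near : ∀ {c} k → c ≡ inj₂ k ⊎ CodeAdj n c (inj₂ k) → toℕ k ∈ nearSubdivisions c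
  dominated-subdivision∈near k (inj₁ refl)                      = here refl
  dominated-subdivision∈near {inj₁ _} k (inj₂ (inj₁ u≡k))   = here (sym u≡k)
  dominated-subdivision∈near {inj₁ _} k (inj₂ (inj₂ u≡1+k)) = there (here (cong pred (sym u≡1+k)))

  subdivisions-covered : ∀ {L} → Dominating (CodeAdj n) L → ∀ k → toℕ k ∈ concatMap nearSubdivisions L
  subdivisions-covered D k with dominator D (inj₂ k)
  ... | s , s∈L , s-near-k = ∈-concatMap⁺ nearSubdivisions (lose s∈L (dominated-subdivision∈near k s-near-k))

  code-lower-bound : ∀ {L} → Dominating (CodeAdj n) L → ⌊ n /2⌋ ≤ length L
  code-lower-bound {L} D = pred≤2*⇒⌊/2⌋≤ n (length L) (begin
    pred n                                ≤⟨ ∈-injective⇒≤-length toℕ-injective (subdivisions-covered D) ⟩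
    length (concatMap nearSubdivisions L) ≤⟨ length-concatMap-≤ length-nearSubdivisions L ⟩
    2 * length L                          ∎)
    where open ≤-Reasoning

lower-bound : ∀ {n} S → Dominating (CentralAdj (Path n)) S → ⌊ n /2⌋ ≤ length S
lower-bound {n} S D = subst (⌊ n /2⌋ ≤_) (length-map encode S) (code-lower-bound (encode-dominating D))

lower-bound-strict : ∀ {n} → (∀ S → Dominating (CentralAdj (Path n)) S → length S ≢ ⌊ n /2⌋) →
  ∀ S → Dominating (CentralAdj (Path n)) S → suc ⌊ n /2⌋ ≤ length S
lower-bound-strict exact-excluded S D = ≤∧≢⇒< (lower-bound S D) (≢-sym (exact-excluded S D))

isDominationNumber : ∀ {n} k (T : List (Fin n)) → Unique T → length T ≡ k →
  Dominating (CodeAdj n) (map inj₁ T) → (∀ S → Dominating (CentralAdj (Path n)) S → k ≤ length S) →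
  IsDominationNumber (CentralAdj (Path n)) k
isDominationNumber k T T-unique |T|≡k T-dominating k-minimal =
  (map inj₁ T , map⁺ inj₁-injective T-unique , vertices-dominating T T-dominating ,
   trans (length-map inj₁ T) |T|≡k) ,
  λ S _ → k-minimal S

no-single-dominator-C[P₃] : ∀ c → ¬ Dominating (CodeAdj 3) (c ∷ [])
no-single-dominator-C[P₃] = toWitness {a? = all-code? λ c → ¬? (codeDominating? (c ∷ []))} tt

no-dominating-pair-C[P₅] : ∀ c d → ¬ Dominating (CodeAdj 5) (c ∷ d ∷ [])
no-dominating-pair-C[P₅] =
  toWitness {a? = all-code? λ c → all-code? λ d → ¬? (codeDominating? (c ∷ d ∷ []))} tt

γ-C[P₃] : IsDominationNumber (CentralAdj (Path 3)) 2
γ-C[P₃] = isDominationNumber 2 (# 0 ∷ # 1 ∷ []) (((λ ()) ∷ []) ∷ [] ∷ []) refl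
  (toWitness {a? = codeDominating? _} tt) (lower-bound-strict size-one-excluded)
  where
  size-one-excluded : ∀ S → Dominating (CentralAdj (Path 3)) S → length S ≢ 1
  size-one-excluded (x ∷ []) D _ = no-single-dominator-C[P₃] (encode x) (encode-dominating D)
  size-one-excluded (_ ∷ _ ∷ _) _ ()

γ-C[P₄] : IsDominationNumber (CentralAdj (Path 4)) 2
γ-C[P₄] = isDominationNumber 2 (# 1 ∷ # 2 ∷ []) (((λ ()) ∷ []) ∷ [] ∷ []) refl
  (toWitness {a? = codeDominating? _} tt) lower-bound

γ-C[P₅] : IsDominationNumber (CentralAdj (Path 5)) 3
γ-C[P₅] = isDominationNumber 3 (# 0 ∷ # 1 ∷ # 3 ∷ []) (((λ ()) ∷ (λ ()) ∷ []) ∷ ((λ ()) ∷ []) ∷ [] ∷ []) refl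
  (toWitness {a? = codeDominating? _} tt) (lower-bound-strict size-two-excluded)
  where
  size-two-excluded : ∀ S → Dominating (CentralAdj (Path 5)) S → length S ≢ 2
  size-two-excluded (x ∷ y ∷ []) D _ = no-dominating-pair-C[P₅] (encode x) (encode y) (encode-dominating D)
  size-two-excluded (_ ∷ _ ∷ _ ∷ _) _ ()

odds : (n : ℕ) → List (Fin n)
odds zero          = []
odds (suc zero)    = []
odds (suc (suc n)) = # 1 ∷ map (F.suc ∘ F.suc) (odds n)

length-odds : ∀ n → length (odds n) ≡ ⌊ n /2⌋
length-odds zero          = refl
length-odds (suc zero)    = refl
length-odds (suc (suc n)) = cong suc (trans (length-map (F.suc ∘ F.suc) (odds n)) (length-odds n))

odds-unique : ∀ n → Unique (odds n)
odds-unique zero          = []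
odds-unique (suc zero)    = []
odds-unique (suc (suc n)) = one-fresh (odds n) ∷ map⁺ suc-suc-injective (odds-unique n)
  where
  one-fresh : ∀ (xs : List (Fin n)) → All (# 1 ≢_) (map (F.suc ∘ F.suc) xs)
  one-fresh []       = []
  one-fresh (_ ∷ xs) = (λ ()) ∷ one-fresh xs
  suc-suc-injective : ∀ {i j : Fin n} → F.suc (F.suc i) ≡ F.suc (F.suc j) → i ≡ j
  suc-suc-injective refl = refl

odd-endpoint : ∀ {n} (k : Fin n) → inject₁ k ∈ odds (suc n) ⊎ F.suc k ∈ odds (suc n)
odd-endpoint               F.zero            = inj₂ (here refl)
odd-endpoint               (F.suc F.zero)    = inj₁ (here refl)
odd-endpoint {suc (suc n)} (F.suc (F.suc k)) =
  Sum.map (there ∘ ∈-map⁺ (F.suc ∘ F.suc)) (there ∘ ∈-map⁺ (F.suc ∘ F.suc)) (odd-endpoint k)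

far-odd-vertex : ∀ m (w : Fin (6 + m)) → ∃[ s ] (s ∈ odds (6 + m) × CentralAdj (Path (6 + m)) (inj₁ s) (inj₁ w))
far-odd-vertex m F.zero                             = # 5 , there (there (here refl)) , (λ ()) , λ { (inj₁ ()) ; (inj₂ ()) }
far-odd-vertex m (F.suc F.zero)                     = # 5 , there (there (here refl)) , (λ ()) , λ { (inj₁ ()) ; (inj₂ ()) }
far-odd-vertex m (F.suc (F.suc F.zero))             = # 5 , there (there (here refl)) , (λ ()) , λ { (inj₁ ()) ; (inj₂ ()) }
far-odd-vertex m (F.suc (F.suc (F.suc F.zero)))     = # 5 , there (there (here refl)) , (λ ()) , λ { (inj₁ ()) ; (inj₂ ()) }
far-odd-vertex m (F.suc (F.suc (F.suc (F.suc w))))  = # 1 , here refl , (λ ()) , λ { (inj₁ ()) ; (inj₂ ()) }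

odds-dominating : ∀ m → Dominating (CodeAdj (6 + m)) (map inj₁ (odds (6 + m)))
odds-dominating m (inj₁ w) with far-odd-vertex m w
... | s , s∈odds , sw = inj₂ (inj₁ s , ∈-map⁺ inj₁ s∈odds , sw)
odds-dominating m (inj₂ k) with odd-endpoint k
... | inj₁ k∈odds   = inj₂ (inj₁ (inject₁ k) , ∈-map⁺ inj₁ k∈odds , inj₁ (toℕ-inject₁ k))
... | inj₂ 1+k∈odds = inj₂ (inj₁ (F.suc k) , ∈-map⁺ inj₁ 1+k∈odds , inj₂ refl)

γ-C[P₆₊] : ∀ m → IsDominationNumber (CentralAdj (Path (6 + m))) ⌊ 6 + m /2⌋
γ-C[P₆₊] m = isDominationNumber _ (odds (6 + m)) (odds-unique (6 + m)) (length-odds (6 + m))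
  (odds-dominating m) lower-bound

theorem4p1 : (n : ℕ) → 3 ≤ n →
    (n ≤ 5 → IsDominationNumber (CentralAdj (Path n)) ⌈ n /2⌉)
    × (6 ≤ n → IsDominationNumber (CentralAdj (Path n)) ⌊ n /2⌋)
theorem4p1 0 ()
theorem4p1 1 (s≤s ())
theorem4p1 2 (s≤s (s≤s ()))
theorem4p1 3 _ = (λ _ → γ-C[P₃]) , λ { (s≤s (s≤s (s≤s ()))) }
theorem4p1 4 _ = (λ _ → γ-C[P₄]) , λ { (s≤s (s≤s (s≤s (s≤s ())))) }
theorem4p1 5 _ = (λ _ → γ-C[P₅]) , λ { (s≤s (s≤s (s≤s (s≤s (s≤s ()))))) }
theorem4p1 (suc (suc (suc (suc (suc (suc m)))))) _ =
  (λ { (s≤s (s≤s (s≤s (s≤s (s≤s ()))))) }) , λ _ → γ-C[P₆₊] m
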